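{- Let $D \ge 1$ and $d \in (\mathbb{N}^*)^D$ with $d[i] \geq 5$ for all $i \in \{1,\dots,D\}$, and let $G_t=(V_t,E_t)$ be the torus graph yielded by $d$. Then the smallest set of maps $V_t \cup\{\bot\} \to V_t\cup\{\bot\}$ that contains all lossless translations on $G_t$, contains the identity, and is closed under composition (the monoid induced by the lossless translations on $G_t$) is exactly the set of Euclidean translations on $G_t$.
   Context: A graph $G=(V,E)$ is finite, simple and undirected. Let $\bot$ be a symbol not in $V$. A transformation on $G$ is a map $\phi : V\cup\{\bot\} \to V \cup\{\bot\}$ with $\phi(\bot)=\bot$ that is injective on $V_{\not\bot} := \{v \in V : \phi(v) \neq \bot\}$; its loss is $|\{v\in V : \phi(v)=\bot\}|$ and it is lossless if its loss is $0$. It is edge-constrained (EC) if $\{v,\phi(v)\} \in E$ for all $v \in V_{\not\bot}$, and strongly neighborhood-preserving (SNP) if for all $v_1,v_2 \in V_{\not\bot}$: $\{v_1,v_2\}\in E \Leftrightarrow \{\phi(v_1),\phi(v_2)\} \in E$. A translation is an EC and SNP transformation. The torus graph yielded by $d \in (\mathbb{N}^*)^D$ has vertex set $V_t = \{1,\dots,d[1]\}\times\cdots\times\{1,\dots,d[D]\}$, and $\{v_1,v_2\} \in E_t$ iff there is $i$ with $|v_1[i]-v_2[i]| \in \{1, d[i]-1\}$ and $v_1[j]=v_2[j]$ for all $j\neq i$; coordinate $i$ is treated as an element of $\mathbb{Z}/d[i]\mathbb{Z}$ (addition modulo $d[i]$, representatives in $\{1,\dots,d[i]\}$). A Euclidean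 translation on $G_t$ is a map $\psi$ with $\psi(\bot)=\bot$ for which there is $\delta \in \mathbb{N}^D$ such that $\psi(v) = v+\delta$ (coordinatewise modulo $d$) for all $v \in V_t$. -}

module Defs where

open import Data.Nat using (ℕ; zero; suc; _+_; _∸_; NonZero; ∣_-_∣)
open import Data.Nat.DivMod using (_mod_)
open import Data.Fin using (Fin; toℕ)
open import Data.Vec using (Vec; []; _∷_; lookup)
open import Data.Unit using (⊤; tt)
open import Data.Product using (_×_; _,_; ∃; Σ)
open import Data.Sum using (_⊎_)
open import Data.Maybe using (Maybe; just; nothing)
open import Function using (_∘_; id; _⇔_)
open import Relation.Nullary using (¬_)
open import Relation.Binary.PropositionalEquality using (_≡_; _≗_)

-- Vertices of the torus graph yielded by d = (d[1],…,d[D]):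
-- tuples (x₁,…,x_D) with xᵢ ∈ Fin d[i]; coordinate i is an element of ℤ/d[i]ℤ,
-- represented by 0,…,d[i]-1 (instead of 1,…,d[i]; this is an isomorphic relabelling).
Vtx : ∀ {D} → Vec ℕ D → Set
Vtx []       = ⊤
Vtx (n ∷ ns) = Fin n × Vtx ns

coord : ∀ {D} (d : Vec ℕ D) → Vtx d → (i : Fin D) → Fin (lookup d i)
coord (n ∷ ns) (x , _)  Fin.zero    = x
coord (n ∷ ns) (_ , xs) (Fin.suc i) = coord ns xs i

Adj : ∀ {D} (d : Vec ℕ D) → Vtx d → Vtx d → Set
Adj {D} d v₁ v₂ =
  ∃ λ (i : Fin D) →
    ((∣ toℕ (coord d v₁ i) - toℕ (coord d v₂ i) ∣ ≡ 1)
      ⊎ (∣ toℕ (coord d v₁ i) - toℕ (coord d v₂ i) ∣ ≡ lookup d i ∸ 1))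
    × (∀ (j : Fin D) → ¬ (j ≡ i) → coord d v₁ j ≡ coord d v₂ j)

-- V ∪ {⊥} is modelled as Maybe V, with ⊥ = nothing.
Map : ∀ {D} → Vec ℕ D → Set
Map d = Maybe (Vtx d) → Maybe (Vtx d)

IsTransformation : ∀ {D} (d : Vec ℕ D) → Map d → Set
IsTransformation d φ =
  (φ nothing ≡ nothing)
  × (∀ (u v w : Vtx d) → φ (just u) ≡ just w → φ (just v) ≡ just w → u ≡ v)

IsLossless : ∀ {D} (d : Vec ℕ D) → Map d → Set
IsLossless d φ = ∀ (v : Vtx d) → ¬ (φ (just v) ≡ nothing)

IsEC : ∀ {D} (d : Vec ℕ D) → Map d → Set
IsEC d φ = ∀ (v w : Vtx d) → φ (just v) ≡ just w → Adj d v w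

IsSNP : ∀ {D} (d : Vec ℕ D) → Map d → Set
IsSNP d φ = ∀ (v₁ v₂ w₁ w₂ : Vtx d) → φ (just v₁) ≡ just w₁ → φ (just v₂) ≡ just w₂ →
  (Adj d v₁ v₂ ⇔ Adj d w₁ w₂)

IsLosslessTranslation : ∀ {D} (d : Vec ℕ D) → Map d → Set
IsLosslessTranslation d φ = IsTransformation d φ × IsLossless d φ × IsEC d φ × IsSNP d φ

shift : ∀ {D} (d : Vec ℕ D) → Vtx d → Vec ℕ D → Vtx d
shift []            _        []       = tt
shift (zero  ∷ ns)  (() , _) _
shift (suc n ∷ ns)  (x , xs) (k ∷ ks) = ((toℕ x + k) mod (suc n)) , shift ns xs ks

IsEuclideanTranslation : ∀ {D} (d : Vec ℕ D) → Map d → Set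
IsEuclideanTranslation {D} d ψ =
  (ψ nothing ≡ nothing) × ∃ λ (δ : Vec ℕ D) → ∀ (v : Vtx d) → ψ (just v) ≡ just (shift d v δ)

data Generated {D} (d : Vec ℕ D) : Map d → Set where
  gen-id    : Generated d id
  gen-trans : ∀ {φ} → IsLosslessTranslation d φ → Generated d φ
  gen-comp  : ∀ {φ ψ} → Generated d φ → Generated d ψ → Generated d (φ ∘ ψ)

-- Membership in the induced monoid, with maps compared extensionally (pointwise).
InInducedMonoid : ∀ {D} (d : Vec ℕ D) → Map d → Set
InInducedMonoid d ψ = ∃ λ φ → Generated d φ × (φ ≗ ψ)

-- A lossless translation φ moves every vertex v to v ⊕ a v for a unit step a v = ±eᵢ.
-- As φ preserves the edge {x, x ⊕ s}, s + a (x ⊕ s) = a x + c for some unit step c, and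
-- since every dᵢ ≥ 5 this identity already holds in ℤᴰ; hence a x = s, a x = a (x ⊕ s) or
-- a (x ⊕ s) = −s. If a x = s, then a keeps the value s along the walk x, x − s, x − 2s, …,
-- which reaches x ⊕ s after dᵢ − 1 steps; the last case is symmetric. So a is constant and
-- φ is a Euclidean translation, and these are closed under composition. Conversely every
-- Euclidean translation is a composite of the lossless translations v ↦ v + eⱼ.
module Submission where

open import Defs
open import Data.Nat
open import Data.Nat.Properties
open import Data.Nat.DivMod
open import Data.Nat.Tactic.RingSolver using (solve-∀)
open import Data.Fin as Fin using (Fin; toℕ)
open import Data.Fin.Properties using (toℕ<n; toℕ-fromℕ<; toℕ-injective)
open import Data.Vec using (Vec; []; _∷_; lookup; replicate; tabulate; zipWith; _[_]%=_)
open import Data.Vec.Properties using (lookup-replicate; lookup∘tabulate; lookup-zipWith; lookup∘updateAt; lookup∘updateAt′)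
open import Data.Maybe as Maybe using (just; nothing)
open import Data.Maybe.Properties using (just-injective)
open import Data.Unit using (tt)
open import Function using (id; _∘_; _⇔_; mk⇔; Equivalence)
open import Function.Construct.Composition using (_⇔-∘_)
open import Function.Construct.Symmetry using (⇔-sym)
open import Data.Product using (∃; _×_; _,_; proj₁; proj₂; map₂)
open import Data.Sum as Sum using (_⊎_; inj₁; inj₂)
open import Relation.Nullary using (yes; no; contradiction)
open import Relation.Binary.PropositionalEquality
open import Algebra.Properties.CommutativeSemigroup +-commutativeSemigroup using (xy∙z≈xz∙y; x∙yz≈xz∙y)
open ≡-Reasoning

-- Arithmetic modulo n

[m%n+k]%n≡[m+k]%n : ∀ m k n .{{_ : NonZero n}} → (m % n + k) % n ≡ (m + k) % n
[m%n+k]%n≡[m+k]%n m k n = begin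
  (m % n + k) % n           ≡⟨ %-distribˡ-+ (m % n) k n ⟩
  (m % n % n + k % n) % n   ≡⟨ cong (λ r → (r + k % n) % n) (m%n%n≡m%n m n) ⟩
  (m % n + k % n) % n       ≡⟨ %-distribˡ-+ m k n ⟨
  (m + k) % n               ∎

m<n⇒[m+kn]%n≡m : ∀ {m} k {n} .{{_ : NonZero n}} → m < n → (m + k * n) % n ≡ m
m<n⇒[m+kn]%n≡m {m} k {n} m<n = trans ([m+kn]%n≡m%n m k n) (m<n⇒m%n≡m m<n)

+-cancelˡ-% : ∀ m {p q} n .{{_ : NonZero n}} → p < n → q < n → (m + p) % n ≡ (m + q) % n → p ≡ q
+-cancelˡ-% m {p} {q} n p<n q<n eq = begin
  p                       ≡⟨ complement p<n ⟨
  (m + p + r) % n         ≡⟨ [m%n+k]%n≡[m+k]%n (m + p) r n ⟨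
  ((m + p) % n + r) % n   ≡⟨ cong (λ s → (s + r) % n) eq ⟩
  ((m + q) % n + r) % n   ≡⟨ [m%n+k]%n≡[m+k]%n (m + q) r n ⟩
  (m + q + r) % n         ≡⟨ complement q<n ⟩
  q                       ∎
  where
  r = n ∸ m % n
  m+r≡0 : (m + r) % n ≡ 0
  m+r≡0 = begin
    (m + r) % n       ≡⟨ [m%n+k]%n≡[m+k]%n m r n ⟨
    (m % n + r) % n   ≡⟨ cong (_% n) (m+[n∸m]≡n (m%n≤n m n)) ⟩
    n % n             ≡⟨ n%n≡0 n ⟩
    0                 ∎
  complement : ∀ {s} → s < n → (m + s + r) % n ≡ s
  complement {s} s<n = begin
    (m + s + r) % n         ≡⟨ cong (_% n) (xy∙z≈xz∙y m s r) ⟩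
    (m + r + s) % n         ≡⟨ [m%n+k]%n≡[m+k]%n (m + r) s n ⟨
    ((m + r) % n + s) % n   ≡⟨ cong (λ t → (t + s) % n) m+r≡0 ⟩
    s % n                   ≡⟨ m<n⇒m%n≡m s<n ⟩
    s                       ∎

data Sign : Set where
  plus minus : Sign

opposite-sign : Sign → Sign
opposite-sign plus  = minus
opposite-sign minus = plus

-- signOffset σ + (n ∸ 1) is a natural number representing the unit σ1 = ±1 modulo n.
signOffset : Sign → ℕ
signOffset plus  = 2
signOffset minus = 0

stepMod : ∀ n .{{_ : NonZero n}} → Sign → ℕ → ℕ
stepMod n σ x = (x + (signOffset σ + (n ∸ 1))) % n

stepMod-plus-< : ∀ {k x} → x < k → stepMod (suc k) plus x ≡ suc x
stepMod-plus-< {k} {x} x<k = begin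
  (x + suc (suc k)) % suc k   ≡⟨ cong (_% suc k) (+-suc x (suc k)) ⟩
  (suc x + suc k) % suc k     ≡⟨ [m+n]%n≡m%n (suc x) (suc k) ⟩
  suc x % suc k               ≡⟨ m<n⇒m%n≡m (s≤s x<k) ⟩
  suc x                       ∎

stepMod-plus-last : ∀ k → stepMod (suc k) plus k ≡ 0
stepMod-plus-last k = begin
  (k + suc (suc k)) % suc k   ≡⟨ cong (_% suc k) (+-suc k (suc k)) ⟩
  (suc k + suc k) % suc k     ≡⟨ [m+n]%n≡m%n (suc k) (suc k) ⟩
  suc k % suc k               ≡⟨ n%n≡0 (suc k) ⟩
  0                           ∎

stepMod-minus-zero : ∀ k → stepMod (suc k) minus 0 ≡ k
stepMod-minus-zero k = m<n⇒m%n≡m (n<1+n k)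

stepMod-minus-suc : ∀ {k x} → x < k → stepMod (suc k) minus (suc x) ≡ x
stepMod-minus-suc {k} {x} x<k = begin
  (suc x + k) % suc k   ≡⟨ cong (_% suc k) (+-suc x k) ⟨
  (x + suc k) % suc k   ≡⟨ [m+n]%n≡m%n x (suc k) ⟩
  x % suc k             ≡⟨ m<n⇒m%n≡m (m<n⇒m<1+n x<k) ⟩
  x                     ∎

Near : ℕ → ℕ → ℕ → Set
Near n x y = ∣ x - y ∣ ≡ 1 ⊎ ∣ x - y ∣ ≡ n ∸ 1

∣n-1+n∣≡1 : ∀ n → ∣ n - suc n ∣ ≡ 1
∣n-1+n∣≡1 zero    = refl
∣n-1+n∣≡1 (suc n) = ∣n-1+n∣≡1 n

∣m-n∣≡k⇒n≡k+m⊎m≡k+n : ∀ {m n k} → ∣ m - n ∣ ≡ k → n ≡ k + m ⊎ m ≡ k + n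
∣m-n∣≡k⇒n≡k+m⊎m≡k+n {zero}  {n}     refl = inj₁ (sym (+-identityʳ n))
∣m-n∣≡k⇒n≡k+m⊎m≡k+n {suc m} {zero}  refl = inj₂ (sym (+-identityʳ (suc m)))
∣m-n∣≡k⇒n≡k+m⊎m≡k+n {suc m} {suc n} {k} eq with ∣m-n∣≡k⇒n≡k+m⊎m≡k+n {m} {n} eq
... | inj₁ n≡k+m = inj₁ (trans (cong suc n≡k+m) (sym (+-suc k m)))
... | inj₂ m≡k+n = inj₂ (trans (cong suc m≡k+n) (sym (+-suc k n)))

stepMod-near : ∀ n .{{_ : NonZero n}} σ {x} → x < n → Near n x (stepMod n σ x)
stepMod-near (suc k) plus {x} (s≤s x≤k) with m≤n⇒m<n∨m≡n x≤k
... | inj₁ x<k  = inj₁ (trans (cong (∣ x -_∣) (stepMod-plus-< x<k)) (∣n-1+n∣≡1 x))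
... | inj₂ refl = inj₂ (trans (cong (∣ x -_∣) (stepMod-plus-last x)) (∣-∣-identityʳ x))
stepMod-near (suc k) minus {zero}  _         = inj₂ (cong (∣ 0 -_∣) (stepMod-minus-zero k))
stepMod-near (suc k) minus {suc x} (s≤s x<k) =
  inj₁ (trans (cong (∣ suc x -_∣) (stepMod-minus-suc x<k)) (trans (∣-∣-comm (suc x) x) (∣n-1+n∣≡1 x)))

near⇒stepMod : ∀ n .{{_ : NonZero n}} {x y} → x < n → y < n → Near n x y → ∃ λ σ → y ≡ stepMod n σ x
near⇒stepMod (suc k) {x} {y} x<n y<n (inj₁ dist≡1) with ∣m-n∣≡k⇒n≡k+m⊎m≡k+n {x} {y} dist≡1
... | inj₁ refl = plus  , sym (stepMod-plus-< (s≤s⁻¹ y<n))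
... | inj₂ refl = minus , sym (stepMod-minus-suc (s≤s⁻¹ x<n))
near⇒stepMod (suc k) {x} {y} x<n y<n (inj₂ dist≡k) with ∣m-n∣≡k⇒n≡k+m⊎m≡k+n {x} {y} dist≡k
... | inj₁ refl = backwards-wrap y<n
  where
  backwards-wrap : ∀ {x} → k + x < suc k → ∃ λ σ → k + x ≡ stepMod (suc k) σ x
  backwards-wrap {zero}  _       = minus , trans (+-identityʳ k) (sym (stepMod-minus-zero k))
  backwards-wrap {suc x} k+x<1+k = contradiction (s≤s⁻¹ k+x<1+k) (m+1+n≰m k)
... | inj₂ refl = forwards-wrap x<n
  where
  forwards-wrap : ∀ {y} → k + y < suc k → ∃ λ σ → y ≡ stepMod (suc k) σ (k + y)
  forwards-wrap {zero}  _       = plus , sym (trans (cong (stepMod (suc k) plus) (+-identityʳ k)) (stepMod-plus-last k))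
  forwards-wrap {suc y} k+y<1+k = contradiction (s≤s⁻¹ k+y<1+k) (m+1+n≰m k)

offset-pigeonhole : ∀ σ {p q r} → p ≤ 2 → q ≤ 2 → r ≤ 2 → r ≢ signOffset (opposite-sign σ) →
                    p + q ≡ signOffset σ + r → p ≡ signOffset σ ⊎ q ≡ signOffset σ
offset-pigeonhole σ {p} {q} {r} p≤2 q≤2 r≤2 r≢ eq with p ≟ signOffset σ | q ≟ signOffset σ
... | yes p≡ | _      = inj₁ p≡
... | no _   | yes q≡ = inj₂ q≡
... | no p≢  | no q≢  = contradiction eq (sums-differ σ r≢ p≢ q≢)
  where
  sums-differ : ∀ σ → r ≢ signOffset (opposite-sign σ) → p ≢ signOffset σ → q ≢ signOffset σ →
                p + q ≢ signOffset σ + r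
  sums-differ plus  r≢0 p≢2 q≢2 = <⇒≢ (≤-trans (s≤s (+-mono-≤ (below p≤2 p≢2) (below q≤2 q≢2)))
                                               (+-monoʳ-≤ 2 (n≢0⇒n>0 r≢0)))
    where
    below : ∀ {m} → m ≤ 2 → m ≢ 2 → m ≤ 1
    below m≤2 m≢2 = s≤s⁻¹ (≤∧≢⇒< m≤2 m≢2)
  sums-differ minus r≢2 p≢0 q≢0 = >⇒≢ (≤-trans (s≤s (s≤s⁻¹ (≤∧≢⇒< r≤2 r≢2)))
                                               (+-mono-≤ (n≢0⇒n>0 p≢0) (n≢0⇒n>0 q≢0)))

-- Unit steps ±eᵢ

Step : ℕ → Set
Step D = Fin D × Sign

opposite : ∀ {D} → Step D → Step D
opposite (i , σ) = i , opposite-sign σ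

-- offset (i , σ) j = 1 + (σeᵢ)ⱼ ∈ {0, 1, 2}, so that sums of steps can be compared in ℕ.
offset : ∀ {D} → Step D → Fin D → ℕ
offset (i , σ) j with i Fin.≟ j
... | yes _ = signOffset σ
... | no  _ = 1

module _ {D : ℕ} where

  opposite-involutive : (u : Step D) → opposite (opposite u) ≡ u
  opposite-involutive (i , plus)  = refl
  opposite-involutive (i , minus) = refl

  opposite-≢ : (u : Step D) → u ≢ opposite u
  opposite-≢ (i , plus)  ()
  opposite-≢ (i , minus) ()

  offset-axis : ∀ i σ → offset {D} (i , σ) i ≡ signOffset σ
  offset-axis i σ with i Fin.≟ i
  ... | yes _   = refl
  ... | no  i≢i = contradiction refl i≢i

  offset-off-axis : ∀ {i j} σ → j ≢ i → offset {D} (i , σ) j ≡ 1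
  offset-off-axis {i} {j} σ j≢i with i Fin.≟ j
  ... | yes refl = contradiction refl j≢i
  ... | no  _    = refl

  offset≤2 : ∀ (u : Step D) j → offset u j ≤ 2
  offset≤2 (i , σ) j with i Fin.≟ j
  offset≤2 (i , plus)  j | yes _ = ≤-refl
  offset≤2 (i , minus) j | yes _ = z≤n
  ... | no _ = s≤s z≤n

  offset-opposite : ∀ (u : Step D) j → offset u j + offset (opposite u) j ≡ 2
  offset-opposite (i , σ) j with i Fin.≟ j
  offset-opposite (i , plus)  j | yes _ = refl
  offset-opposite (i , minus) j | yes _ = refl
  ... | no _ = refl

  offset≡signOffset⇒ : ∀ (u : Step D) {j} σ → offset u j ≡ signOffset σ → u ≡ (j , σ)
  offset≡signOffset⇒ (i , τ) {j} σ eq with i Fin.≟ j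
  offset≡signOffset⇒ (i , plus)  plus  eq | yes refl = refl
  offset≡signOffset⇒ (i , minus) minus eq | yes refl = refl
  offset≡signOffset⇒ (i , plus)  minus () | yes refl
  offset≡signOffset⇒ (i , minus) plus  () | yes refl
  offset≡signOffset⇒ (i , τ)     plus  () | no _
  offset≡signOffset⇒ (i , τ)     minus () | no _

  offsets-sum-to-2⇒opposite : ∀ (s b : Step D) → (∀ j → offset s j + offset b j ≡ 2) → b ≡ opposite s
  offsets-sum-to-2⇒opposite (i , σ) b sum≡2 = offset≡signOffset⇒ b (opposite-sign σ)
    (other-offset σ (trans (cong (_+ offset b i) (sym (offset-axis i σ))) (sum≡2 i)))
    where
    other-offset : ∀ σ → signOffset σ + offset b i ≡ 2 → offset b i ≡ signOffset (opposite-sign σ)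
    other-offset plus  eq = +-cancelˡ-≡ 2 _ _ eq
    other-offset minus eq = eq

  steps-sum-equal⇒ : ∀ (s b a c : Step D) → (∀ j → offset s j + offset b j ≡ offset a j + offset c j) →
                     a ≡ s ⊎ a ≡ b ⊎ b ≡ opposite s
  steps-sum-equal⇒ s b a@(i , σ) c sums with offset c i ≟ signOffset (opposite-sign σ)
  ... | yes c≡ = inj₂ (inj₂ (offsets-sum-to-2⇒opposite s b λ j → begin
    offset s j + offset b j                ≡⟨ sums j ⟩
    offset a j + offset c j                ≡⟨ cong (λ u → offset a j + offset u j) (offset≡signOffset⇒ c _ c≡) ⟩
    offset a j + offset (opposite a) j     ≡⟨ offset-opposite a j ⟩
    2                                      ∎))
  ... | no c≢ = Sum.map (sym ∘ offset≡signOffset⇒ s σ) (inj₁ ∘ sym ∘ offset≡signOffset⇒ b σ)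
    (offset-pigeonhole σ (offset≤2 s i) (offset≤2 b i) (offset≤2 c i) c≢
      (trans (sums i) (cong (_+ offset c i) (offset-axis i σ))))

-- Translations of the torus

Vecℕ-induction : ∀ {D} (P : Vec ℕ D → Set) → P (replicate D 0) →
                 (∀ δ j → P δ → P (δ [ j ]%= suc)) → ∀ δ → P δ
Vecℕ-induction {zero}  P P0 Psuc [] = P0
Vecℕ-induction {suc D} P P0 Psuc (k ∷ δ) =
  Vecℕ-induction (λ δ → ∀ k → P (k ∷ δ)) P-axis (λ δ j Pδ k → Psuc (k ∷ δ) (Fin.suc j) (Pδ k)) δ k
  where
  P-axis : ∀ k → P (k ∷ replicate D 0)
  P-axis zero    = P0
  P-axis (suc k) = Psuc (k ∷ replicate D 0) Fin.zero (P-axis k)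

toℕ-coord-shift : ∀ {D} (d : Vec ℕ D) (v : Vtx d) δ j .{{_ : NonZero (lookup d j)}} →
                  toℕ (coord d (shift d v δ) j) ≡ (toℕ (coord d v j) + lookup δ j) % lookup d j
toℕ-coord-shift (suc n ∷ d) (x , v) (k ∷ δ) Fin.zero    = toℕ-fromℕ< _
toℕ-coord-shift (suc n ∷ d) (x , v) (k ∷ δ) (Fin.suc j) = toℕ-coord-shift d v δ j

coord-ext : ∀ {D} (d : Vec ℕ D) {v w : Vtx d} → (∀ j → toℕ (coord d v j) ≡ toℕ (coord d w j)) → v ≡ w
coord-ext []      {tt}    {tt}    _  = refl
coord-ext (n ∷ d) {x , v} {y , w} eq = cong₂ _,_ (toℕ-injective (eq Fin.zero)) (coord-ext d (eq ∘ Fin.suc))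

origin : ∀ {D} (d : Vec ℕ D) → (∀ i → 0 < lookup d i) → Vtx d
origin []          _   = tt
origin (zero  ∷ d) d>0 = contradiction (d>0 Fin.zero) (λ ())
origin (suc n ∷ d) d>0 = Fin.zero , origin d (d>0 ∘ Fin.suc)

toℕ-coord-origin : ∀ {D} (d : Vec ℕ D) d>0 j → toℕ (coord d (origin d d>0) j) ≡ 0
toℕ-coord-origin (zero  ∷ d) d>0 j           = contradiction (d>0 Fin.zero) (λ ())
toℕ-coord-origin (suc n ∷ d) d>0 Fin.zero    = refl
toℕ-coord-origin (suc n ∷ d) d>0 (Fin.suc j) = toℕ-coord-origin d (d>0 ∘ Fin.suc) j

translate : ∀ {D} (d : Vec ℕ D) → Vec ℕ D → Map d
translate d δ = Maybe.map (λ v → shift d v δ)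

isEuclideanTranslation⇔≗translate : ∀ {D} (d : Vec ℕ D) (ψ : Map d) →
                                    IsEuclideanTranslation d ψ ⇔ ∃ λ δ → ψ ≗ translate d δ
isEuclideanTranslation⇔≗translate d ψ = mk⇔
  (λ (ψ⊥ , δ , ψv) → δ , λ { nothing → ψ⊥ ; (just v) → ψv v })
  (λ (δ , ψ≗) → ψ≗ nothing , δ , ψ≗ ∘ just)

module Shifts {D} (d : Vec ℕ D) (d>0 : ∀ i → 0 < lookup d i) where

  N : Fin D → ℕ
  N = lookup d

  instance
    N-nonZero : ∀ {i} → NonZero (N i)
    N-nonZero {i} = >-nonZero (d>0 i)

  pos : Vtx d → Fin D → ℕ
  pos v j = toℕ (coord d v j)

  pos<N : ∀ v j → pos v j < N j
  pos<N v j = toℕ<n (coord d v j)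

  pos-shift : ∀ v δ j → pos (shift d v δ) j ≡ (pos v j + lookup δ j) % N j
  pos-shift v δ j = toℕ-coord-shift d v δ j

  pos-shift-shift : ∀ v δ δ′ j → pos (shift d (shift d v δ) δ′) j ≡ (pos v j + (lookup δ j + lookup δ′ j)) % N j
  pos-shift-shift v δ δ′ j = begin
    pos (shift d (shift d v δ) δ′) j                  ≡⟨ pos-shift (shift d v δ) δ′ j ⟩
    (pos (shift d v δ) j + lookup δ′ j) % N j          ≡⟨ cong (λ p → (p + lookup δ′ j) % N j) (pos-shift v δ j) ⟩
    ((pos v j + lookup δ j) % N j + lookup δ′ j) % N j ≡⟨ [m%n+k]%n≡[m+k]%n (pos v j + lookup δ j) (lookup δ′ j) (N j) ⟩
    (pos v j + lookup δ j + lookup δ′ j) % N j         ≡⟨ cong (_% N j) (+-assoc (pos v j) (lookup δ j) (lookup δ′ j)) ⟩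
    (pos v j + (lookup δ j + lookup δ′ j)) % N j       ∎

  shift-zeros : ∀ v → shift d v (replicate D 0) ≡ v
  shift-zeros v = coord-ext d λ j → begin
    pos (shift d v (replicate D 0)) j                ≡⟨ pos-shift v (replicate D 0) j ⟩
    (pos v j + lookup (replicate D 0) j) % N j       ≡⟨ cong (λ k → (pos v j + k) % N j) (lookup-replicate j 0) ⟩
    (pos v j + 0) % N j                              ≡⟨ m<n⇒[m+kn]%n≡m 0 (pos<N v j) ⟩
    pos v j                                          ∎

  shift-shift : ∀ v δ δ′ → shift d (shift d v δ) δ′ ≡ shift d v (zipWith _+_ δ δ′)
  shift-shift v δ δ′ = coord-ext d λ j → begin
    pos (shift d (shift d v δ) δ′) j                ≡⟨ pos-shift-shift v δ δ′ j ⟩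
    (pos v j + (lookup δ j + lookup δ′ j)) % N j    ≡⟨ cong (λ k → (pos v j + k) % N j) (lookup-zipWith _+_ j δ δ′) ⟨
    (pos v j + lookup (zipWith _+_ δ δ′) j) % N j   ≡⟨ pos-shift v (zipWith _+_ δ δ′) j ⟨
    pos (shift d v (zipWith _+_ δ δ′)) j            ∎

  shift-comm : ∀ v δ δ′ → shift d (shift d v δ) δ′ ≡ shift d (shift d v δ′) δ
  shift-comm v δ δ′ = coord-ext d λ j → begin
    pos (shift d (shift d v δ) δ′) j               ≡⟨ pos-shift-shift v δ δ′ j ⟩
    (pos v j + (lookup δ j + lookup δ′ j)) % N j   ≡⟨ cong (λ k → (pos v j + k) % N j) (+-comm (lookup δ j) (lookup δ′ j)) ⟩
    (pos v j + (lookup δ′ j + lookup δ j)) % N j   ≡⟨ pos-shift-shift v δ′ δ j ⟨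
    pos (shift d (shift d v δ′) δ) j               ∎

  origin₀ : Vtx d
  origin₀ = origin d d>0

  shift-origin : ∀ v → shift d origin₀ (tabulate (pos v)) ≡ v
  shift-origin v = coord-ext d λ j → begin
    pos (shift d origin₀ (tabulate (pos v))) j                 ≡⟨ pos-shift origin₀ (tabulate (pos v)) j ⟩
    (pos origin₀ j + lookup (tabulate (pos v)) j) % N j        ≡⟨ cong₂ (λ p q → (p + q) % N j) (toℕ-coord-origin d d>0 j) (lookup∘tabulate (pos v) j) ⟩
    pos v j % N j                                              ≡⟨ m<n⇒m%n≡m (pos<N v j) ⟩
    pos v j                                                    ∎

  translate-zeros : id ≗ translate d (replicate D 0)
  translate-zeros nothing  = refl
  translate-zeros (just v) = cong just (sym (shift-zeros v))

  translate-∘ : ∀ δ δ′ → translate d δ′ ∘ translate d δ ≗ translate d (zipWith _+_ δ δ′)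
  translate-∘ δ δ′ nothing  = refl
  translate-∘ δ δ′ (just v) = cong just (shift-shift v δ δ′)

module UnitSteps {D} (d : Vec ℕ D) (d≥5 : ∀ i → 5 ≤ lookup d i) where

  open Shifts d (λ i → ≤-trans (s≤s z≤n) (d≥5 i))

  stepVec : Step D → Vec ℕ D
  stepVec u = tabulate λ j → offset u j + (N j ∸ 1)

  infixl 6 _⊕_
  _⊕_ : Vtx d → Step D → Vtx d
  v ⊕ u = shift d v (stepVec u)

  pos-⊕ : ∀ v u j → pos (v ⊕ u) j ≡ (pos v j + (offset u j + (N j ∸ 1))) % N j
  pos-⊕ v u j = trans (pos-shift v (stepVec u) j) (cong (λ k → (pos v j + k) % N j) (lookup∘tabulate _ j))

  pos-⊕-axis : ∀ v i σ → pos (v ⊕ (i , σ)) i ≡ stepMod (N i) σ (pos v i)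
  pos-⊕-axis v i σ = trans (pos-⊕ v (i , σ) i) (cong (λ o → (pos v i + (o + (N i ∸ 1))) % N i) (offset-axis i σ))

  pos-⊕-off-axis : ∀ v {i j} σ → j ≢ i → pos (v ⊕ (i , σ)) j ≡ pos v j
  pos-⊕-off-axis v {i} {j} σ j≢i = begin
    pos (v ⊕ (i , σ)) j                                ≡⟨ pos-⊕ v (i , σ) j ⟩
    (pos v j + (offset (i , σ) j + (N j ∸ 1))) % N j   ≡⟨ cong (λ o → (pos v j + (o + (N j ∸ 1))) % N j) (offset-off-axis σ j≢i) ⟩
    (pos v j + suc (N j ∸ 1)) % N j                    ≡⟨ cong (λ k → (pos v j + k) % N j) (suc-pred (N j)) ⟩
    (pos v j + N j) % N j                              ≡⟨ [m+n]%n≡m%n (pos v j) (N j) ⟩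
    pos v j % N j                                      ≡⟨ m<n⇒m%n≡m (pos<N v j) ⟩
    pos v j                                            ∎

  pos-⊕-⊕ : ∀ v u u′ j → pos (v ⊕ u ⊕ u′) j ≡ (pos v j + (offset u j + offset u′ j + 2 * (N j ∸ 1))) % N j
  pos-⊕-⊕ v u u′ j = begin
    pos (v ⊕ u ⊕ u′) j
      ≡⟨ pos-shift-shift v (stepVec u) (stepVec u′) j ⟩
    (pos v j + (lookup (stepVec u) j + lookup (stepVec u′) j)) % N j
      ≡⟨ cong₂ (λ a b → (pos v j + (a + b)) % N j) (lookup∘tabulate _ j) (lookup∘tabulate _ j) ⟩
    (pos v j + ((offset u j + (N j ∸ 1)) + (offset u′ j + (N j ∸ 1)))) % N j
      ≡⟨ cong (λ k → (pos v j + k) % N j) (interchange (offset u j) (offset u′ j) (N j ∸ 1)) ⟩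
    (pos v j + (offset u j + offset u′ j + 2 * (N j ∸ 1))) % N j
      ∎
    where
    interchange : ∀ p q m → (p + m) + (q + m) ≡ p + q + 2 * m
    interchange = solve-∀

  ⊕-opposite : ∀ v u → v ⊕ u ⊕ opposite u ≡ v
  ⊕-opposite v u = coord-ext d λ j → begin
    pos (v ⊕ u ⊕ opposite u) j                                        ≡⟨ pos-⊕-⊕ v u (opposite u) j ⟩
    (pos v j + (offset u j + offset (opposite u) j + 2 * (N j ∸ 1))) % N j ≡⟨ cong (λ k → (pos v j + (k + 2 * (N j ∸ 1))) % N j) (offset-opposite u j) ⟩
    (pos v j + (2 + 2 * (N j ∸ 1))) % N j                             ≡⟨ cong (λ k → (pos v j + k) % N j) (*-suc 2 (N j ∸ 1)) ⟨
    (pos v j + 2 * suc (N j ∸ 1)) % N j                               ≡⟨ cong (λ k → (pos v j + 2 * k) % N j) (suc-pred (N j)) ⟩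
    (pos v j + 2 * N j) % N j                                         ≡⟨ m<n⇒[m+kn]%n≡m 2 (pos<N v j) ⟩
    pos v j                                                           ∎

  ⊕-opposite-⊕ : ∀ v u → v ⊕ opposite u ⊕ u ≡ v
  ⊕-opposite-⊕ v u = subst (λ u′ → v ⊕ opposite u ⊕ u′ ≡ v) (opposite-involutive u) (⊕-opposite v (opposite u))

  ⊕-injective : ∀ {v w} u → v ⊕ u ≡ w ⊕ u → v ≡ w
  ⊕-injective {v} {w} u eq = begin
    v                    ≡⟨ ⊕-opposite v u ⟨
    v ⊕ u ⊕ opposite u   ≡⟨ cong (_⊕ opposite u) eq ⟩
    w ⊕ u ⊕ opposite u   ≡⟨ ⊕-opposite w u ⟩
    w                    ∎

  ⊕-comm : ∀ v u u′ → v ⊕ u ⊕ u′ ≡ v ⊕ u′ ⊕ u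
  ⊕-comm v u u′ = shift-comm v (stepVec u) (stepVec u′)

  -- Two-step displacements are below 5 ≤ N j, so they do not wrap around.
  ⊕-⊕-offsets : ∀ x s b a c → x ⊕ s ⊕ b ≡ x ⊕ a ⊕ c → ∀ j → offset s j + offset b j ≡ offset a j + offset c j
  ⊕-⊕-offsets x s b a c eq j = +-cancelˡ-% (pos x j + 2 * (N j ∸ 1)) (N j) (small s b) (small a c) (begin
    (pos x j + 2 * (N j ∸ 1) + (offset s j + offset b j)) % N j   ≡⟨ cong (_% N j) (x∙yz≈xz∙y (pos x j) _ _) ⟨
    (pos x j + (offset s j + offset b j + 2 * (N j ∸ 1))) % N j   ≡⟨ pos-⊕-⊕ x s b j ⟨
    pos (x ⊕ s ⊕ b) j                                             ≡⟨ cong (λ v → pos v j) eq ⟩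
    pos (x ⊕ a ⊕ c) j                                             ≡⟨ pos-⊕-⊕ x a c j ⟩
    (pos x j + (offset a j + offset c j + 2 * (N j ∸ 1))) % N j   ≡⟨ cong (_% N j) (x∙yz≈xz∙y (pos x j) _ _) ⟩
    (pos x j + 2 * (N j ∸ 1) + (offset a j + offset c j)) % N j   ∎)
    where
    small : ∀ u u′ → offset u j + offset u′ j < N j
    small u u′ = ≤-trans (s≤s (+-mono-≤ (offset≤2 u j) (offset≤2 u′ j))) (d≥5 j)

  adj-⊕ : ∀ v u → Adj d v (v ⊕ u)
  adj-⊕ v (i , σ) =
    i , subst (Near (N i) (pos v i)) (sym (pos-⊕-axis v i σ)) (stepMod-near (N i) σ (pos<N v i))
      , λ j j≢i → toℕ-injective (sym (pos-⊕-off-axis v σ j≢i))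

  adj⇒⊕ : ∀ {v w} → Adj d v w → ∃ λ u → w ≡ v ⊕ u
  adj⇒⊕ {v} {w} (i , near , off-axis) with near⇒stepMod (N i) (pos<N v i) (pos<N w i) near
  ... | σ , w≡ = (i , σ) , coord-ext d same-pos
    where
    same-pos : ∀ j → pos w j ≡ pos (v ⊕ (i , σ)) j
    same-pos j with j Fin.≟ i
    ... | yes refl = trans w≡ (sym (pos-⊕-axis v i σ))
    ... | no  j≢i  = trans (cong toℕ (sym (off-axis j j≢i))) (sym (pos-⊕-off-axis v σ j≢i))

  ⊕-preserves-adj : ∀ u {v w} → Adj d v w → Adj d (v ⊕ u) (w ⊕ u)
  ⊕-preserves-adj u {v} adj with adj⇒⊕ adj
  ... | u′ , refl = subst (Adj d (v ⊕ u)) (⊕-comm v u u′) (adj-⊕ (v ⊕ u) u′)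

  ⊕-reflects-adj : ∀ u {v w} → Adj d (v ⊕ u) (w ⊕ u) → Adj d v w
  ⊕-reflects-adj u {v} {w} adj = subst₂ (Adj d) (⊕-opposite v u) (⊕-opposite w u) (⊕-preserves-adj (opposite u) adj)

  walk : ℕ → Step D → Vtx d → Vtx d
  walk zero    u v = v
  walk (suc k) u v = walk k u v ⊕ u

  pos-walk : ∀ k u v j → pos (walk k u v) j ≡ (pos v j + k * (offset u j + (N j ∸ 1))) % N j
  pos-walk zero    u v j = sym (m<n⇒[m+kn]%n≡m 0 (pos<N v j))
  pos-walk (suc k) u v j = begin
    pos (walk k u v ⊕ u) j                   ≡⟨ pos-⊕ (walk k u v) u j ⟩
    (pos (walk k u v) j + t) % N j           ≡⟨ cong (λ p → (p + t) % N j) (pos-walk k u v j) ⟩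
    ((pos v j + k * t) % N j + t) % N j      ≡⟨ [m%n+k]%n≡[m+k]%n (pos v j + k * t) t (N j) ⟩
    (pos v j + k * t + t) % N j              ≡⟨ cong (_% N j) (x∙yz≈xz∙y (pos v j) t (k * t)) ⟨
    (pos v j + suc k * t) % N j              ∎
    where
    t = offset u j + (N j ∸ 1)

  walk-period : ∀ v (u : Step D) → walk (N (proj₁ u)) u v ≡ v
  walk-period v u@(i , σ) = coord-ext d λ j → trans (pos-walk (N i) u v j) (full-turns j)
    where
    full-turns : ∀ j → (pos v j + N i * (offset u j + (N j ∸ 1))) % N j ≡ pos v j
    full-turns j with j Fin.≟ i
    ... | yes refl = trans (cong (λ k → (pos v j + k) % N j) (*-comm (N j) _)) (m<n⇒[m+kn]%n≡m (offset u j + (N j ∸ 1)) (pos<N v j))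
    ... | no  j≢i  = trans (cong (λ k → (pos v j + N i * k) % N j) one-turn) (m<n⇒[m+kn]%n≡m (N i) (pos<N v j))
      where
      one-turn : offset u j + (N j ∸ 1) ≡ N j
      one-turn = trans (cong (_+ (N j ∸ 1)) (offset-off-axis σ j≢i)) (suc-pred (N j))

  walk-around : ∀ v (u : Step D) → walk (N (proj₁ u) ∸ 1) (opposite u) v ≡ v ⊕ u
  walk-around v u = begin
    walk k (opposite u) v                        ≡⟨ ⊕-opposite-⊕ (walk k (opposite u) v) u ⟨
    walk k (opposite u) v ⊕ opposite u ⊕ u       ≡⟨ cong (_⊕ u) full-turn ⟩
    v ⊕ u                                        ∎
    where
    k = N (proj₁ u) ∸ 1
    full-turn : walk (suc k) (opposite u) v ≡ v
    full-turn = subst (λ n → walk n (opposite u) v ≡ v) (sym (suc-pred (N (proj₁ u)))) (walk-period v (opposite u))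

  shift-suc : ∀ v δ j → shift d v (δ [ j ]%= suc) ≡ shift d v δ ⊕ (j , plus)
  shift-suc v δ j = coord-ext d λ j′ → begin
    pos (shift d v (δ [ j ]%= suc)) j′                                 ≡⟨ pos-shift v (δ [ j ]%= suc) j′ ⟩
    (pos v j′ + lookup (δ [ j ]%= suc) j′) % N j′                      ≡⟨ [m+n]%n≡m%n _ (N j′) ⟨
    (pos v j′ + lookup (δ [ j ]%= suc) j′ + N j′) % N j′               ≡⟨ cong (_% N j′) (+-assoc (pos v j′) _ (N j′)) ⟩
    (pos v j′ + (lookup (δ [ j ]%= suc) j′ + N j′)) % N j′             ≡⟨ cong (λ k → (pos v j′ + k) % N j′) (displacement j′) ⟩
    (pos v j′ + (lookup δ j′ + lookup (stepVec (j , plus)) j′)) % N j′ ≡⟨ pos-shift-shift v δ (stepVec (j , plus)) j′ ⟨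
    pos (shift d v δ ⊕ (j , plus)) j′                                  ∎
    where
    displacement : ∀ j′ → lookup (δ [ j ]%= suc) j′ + N j′ ≡ lookup δ j′ + lookup (stepVec (j , plus)) j′
    displacement j′ with j′ Fin.≟ j
    ... | yes refl = begin
      lookup (δ [ j′ ]%= suc) j′ + N j′                ≡⟨ cong (_+ N j′) (lookup∘updateAt j′ δ) ⟩
      suc (lookup δ j′ + N j′)                         ≡⟨ +-suc (lookup δ j′) (N j′) ⟨
      lookup δ j′ + suc (N j′)                         ≡⟨ cong (λ n → lookup δ j′ + suc n) (suc-pred (N j′)) ⟨
      lookup δ j′ + (2 + (N j′ ∸ 1))                   ≡⟨ cong (λ o → lookup δ j′ + (o + (N j′ ∸ 1))) (offset-axis j′ plus) ⟨
      lookup δ j′ + (offset (j′ , plus) j′ + (N j′ ∸ 1)) ≡⟨ cong (lookup δ j′ +_) (lookup∘tabulate _ j′) ⟨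
      lookup δ j′ + lookup (stepVec (j′ , plus)) j′    ∎
    ... | no j′≢j = begin
      lookup (δ [ j ]%= suc) j′ + N j′                 ≡⟨ cong (_+ N j′) (lookup∘updateAt′ j′ j j′≢j δ) ⟩
      lookup δ j′ + N j′                               ≡⟨ cong (lookup δ j′ +_) (suc-pred (N j′)) ⟨
      lookup δ j′ + (1 + (N j′ ∸ 1))                   ≡⟨ cong (λ o → lookup δ j′ + (o + (N j′ ∸ 1))) (offset-off-axis plus j′≢j) ⟨
      lookup δ j′ + (offset (j , plus) j′ + (N j′ ∸ 1)) ≡⟨ cong (lookup δ j′ +_) (lookup∘tabulate _ j′) ⟨
      lookup δ j′ + lookup (stepVec (j , plus)) j′     ∎

  step-isLosslessTranslation : ∀ u → IsLosslessTranslation d (translate d (stepVec u))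
  step-isLosslessTranslation u =
      (refl , λ v w _ eq₁ eq₂ → ⊕-injective u (trans (just-injective eq₁) (sym (just-injective eq₂))))
    , (λ v ())
    , (λ v w eq → subst (Adj d v) (just-injective eq) (adj-⊕ v u))
    , λ v₁ v₂ w₁ w₂ eq₁ eq₂ → subst₂ (λ w₁ w₂ → Adj d v₁ v₂ ⇔ Adj d w₁ w₂) (just-injective eq₁) (just-injective eq₂)
                                      (mk⇔ (⊕-preserves-adj u) (⊕-reflects-adj u))

  translate-suc : ∀ δ j → translate d (stepVec (j , plus)) ∘ translate d δ ≗ translate d (δ [ j ]%= suc)
  translate-suc δ j nothing  = refl
  translate-suc δ j (just v) = cong just (sym (shift-suc v δ j))

  translate-inInducedMonoid : ∀ δ → InInducedMonoid d (translate d δ)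
  translate-inInducedMonoid = Vecℕ-induction (InInducedMonoid d ∘ translate d) (id , gen-id , translate-zeros)
    λ δ j (φ , gφ , φ≗) → translate d (stepVec (j , plus)) ∘ φ
                        , gen-comp (gen-trans {φ = translate d (stepVec (j , plus))} (step-isLosslessTranslation (j , plus))) gφ
                        , λ x → trans (cong (translate d (stepVec (j , plus))) (φ≗ x)) (translate-suc δ j x)

  module StepField (a : Vtx d → Step D) (preserves : ∀ {v w} → Adj d v w → Adj d (v ⊕ a v) (w ⊕ a w)) where

    trichotomy : ∀ x s → a x ≡ s ⊎ a x ≡ a (x ⊕ s) ⊎ a (x ⊕ s) ≡ opposite s
    trichotomy x s with adj⇒⊕ (preserves (adj-⊕ x s))
    ... | c , eq = steps-sum-equal⇒ s (a (x ⊕ s)) (a x) c (⊕-⊕-offsets x s (a (x ⊕ s)) (a x) c eq)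

    persists-backward : ∀ {x s} → a x ≡ s → a (x ⊕ opposite s) ≡ s
    persists-backward {x} {s} ax≡s = from-cases (trichotomy (x ⊕ opposite s) s)
      where
      y = x ⊕ opposite s
      back : a (y ⊕ s) ≡ a x
      back = cong a (⊕-opposite-⊕ x s)
      from-cases : a y ≡ s ⊎ a y ≡ a (y ⊕ s) ⊎ a (y ⊕ s) ≡ opposite s → a y ≡ s
      from-cases (inj₁ ay≡s)         = ay≡s
      from-cases (inj₂ (inj₁ ay≡ax)) = trans ay≡ax (trans back ax≡s)
      from-cases (inj₂ (inj₂ ax≡-s)) = contradiction (trans (sym ax≡s) (trans (sym back) ax≡-s)) (opposite-≢ s)

    persists-along-walk : ∀ {x s} → a x ≡ s → ∀ k → a (walk k (opposite s) x) ≡ s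
    persists-along-walk ax≡s zero    = ax≡s
    persists-along-walk ax≡s (suc k) = persists-backward (persists-along-walk ax≡s k)

    ⊕-invariant : ∀ x s → a (x ⊕ s) ≡ a x
    ⊕-invariant x s = from-cases (trichotomy x s)
      where
      from-cases : a x ≡ s ⊎ a x ≡ a (x ⊕ s) ⊎ a (x ⊕ s) ≡ opposite s → a (x ⊕ s) ≡ a x
      from-cases (inj₁ ax≡s) = begin
        a (x ⊕ s)                                        ≡⟨ cong a (walk-around x s) ⟨
        a (walk (N (proj₁ s) ∸ 1) (opposite s) x)        ≡⟨ persists-along-walk ax≡s (N (proj₁ s) ∸ 1) ⟩
        s                                                ≡⟨ ax≡s ⟨
        a x                                              ∎
      from-cases (inj₂ (inj₁ ax≡ay)) = sym ax≡ay
      from-cases (inj₂ (inj₂ ay≡-s)) = begin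
        a (x ⊕ s)                                                    ≡⟨ ay≡-s ⟩
        opposite s                                                   ≡⟨ persists-along-walk ay≡-s (N (proj₁ s) ∸ 1) ⟨
        a (walk (N (proj₁ s) ∸ 1) (opposite (opposite s)) (x ⊕ s))   ≡⟨ cong a (walk-around (x ⊕ s) (opposite s)) ⟩
        a (x ⊕ s ⊕ opposite s)                                       ≡⟨ cong a (⊕-opposite x s) ⟩
        a x                                                          ∎

    shift-invariant : ∀ δ x → a (shift d x δ) ≡ a x
    shift-invariant = Vecℕ-induction (λ δ → ∀ x → a (shift d x δ) ≡ a x) (cong a ∘ shift-zeros)
      λ δ j IH x → trans (cong a (shift-suc x δ j)) (trans (⊕-invariant (shift d x δ) (j , plus)) (IH x))

    constant : ∀ v → a v ≡ a origin₀
    constant v = trans (cong a (sym (shift-origin v))) (shift-invariant (tabulate (pos v)) origin₀)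

  losslessTranslation⇒≗translate : ∀ {φ} → IsLosslessTranslation d φ → ∃ λ δ → φ ≗ translate d δ
  losslessTranslation⇒≗translate {φ} ((φ⊥ , _) , lossless , ec , snp) = stepVec (a origin₀) , φ≗
    where
    step-of : ∀ v → ∃ λ u → φ (just v) ≡ just (v ⊕ u)
    step-of v with φ (just v) in eq
    ... | nothing = contradiction eq (lossless v)
    ... | just w  = map₂ (cong just) (adj⇒⊕ (ec v w eq))

    a : Vtx d → Step D
    a v = proj₁ (step-of v)

    φ-a : ∀ v → φ (just v) ≡ just (v ⊕ a v)
    φ-a v = proj₂ (step-of v)

    φ≗ : φ ≗ translate d (stepVec (a origin₀))
    φ≗ nothing  = φ⊥
    φ≗ (just v) = trans (φ-a v) (cong (λ u → just (v ⊕ u))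
      (StepField.constant a (λ {v} {w} → Equivalence.to (snp v w _ _ (φ-a v) (φ-a w))) v))

  generated⇒≗translate : ∀ {φ} → Generated d φ → ∃ λ δ → φ ≗ translate d δ
  generated⇒≗translate gen-id        = replicate D 0 , translate-zeros
  generated⇒≗translate (gen-trans T) = losslessTranslation⇒≗translate T
  generated⇒≗translate (gen-comp {φ} {ψ} gφ gψ) with generated⇒≗translate gφ | generated⇒≗translate gψ
  ... | δ , φ≗ | δ′ , ψ≗ = zipWith _+_ δ′ δ , λ x → trans (trans (cong φ (ψ≗ x)) (φ≗ _)) (translate-∘ δ′ δ x)

  inInducedMonoid⇔≗translate : ∀ ψ → InInducedMonoid d ψ ⇔ ∃ λ δ → ψ ≗ translate d δ
  inInducedMonoid⇔≗translate ψ = mk⇔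
    (λ (φ , gφ , φ≗ψ) → map₂ (λ φ≗ x → trans (sym (φ≗ψ x)) (φ≗ x)) (generated⇒≗translate gφ))
    (λ (δ , ψ≗) → map₂ (map₂ λ φ≗ x → trans (φ≗ x) (sym (ψ≗ x))) (translate-inInducedMonoid δ))

proposition12 : ∀ {D : ℕ} (d : Vec ℕ D) → 1 ≤ D → (∀ (i : Fin D) → 5 ≤ lookup d i) →
    ∀ (ψ : Map d) → (InInducedMonoid d ψ ⇔ IsEuclideanTranslation d ψ)
proposition12 d _ d≥5 ψ = ⇔-sym (isEuclideanTranslation⇔≗translate d ψ) ⇔-∘ inInducedMonoid⇔≗translate ψ
  where open UnitSteps d d≥5
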